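{- Let $D$ be a $k$-minimal digraph of order $n$ which has a balanced acyclic complete coloring with $k$ colors, with chromatic classes of size $q$, so $qk=n$. Let $m\geq 2$ and let $H$ be a digraph. If $K_m$ has a relabel $H$-factorization into $q$ factors, then the lexicographic product $D[H]$ is $km$-minimal and has a balanced acyclic complete coloring with $km$ colors.
   Context: All digraphs are finite and simple (2-cycles allowed). $K_m$ is the complete symmetric digraph on $m$ vertices. A coloring with $k$ colors is a surjection $V(D)\to[k]$; chromatic classes are color preimages. Acyclic: every chromatic class induces a subdigraph with no directed cycle. Complete: for every ordered pair $(i,j)$ of distinct colors there is an arc from a vertex colored $i$ to one colored $j$. Balanced: all chromatic classes have the same size. $\mathrm{dac}(D)$ is the largest $k$ such that $D$ has an acyclic complete coloring with $k$ colors; $D$ is $k$-minimal if $\mathrm{dac}(D)=k$ and $\mathrm{dac}(D-f)<k$ for every arc $f$. A relabel factorization of $K_m$ into $q$ factors is a family of $q$ pairwise vertex-disjoint digraphs $H_1,\dots,H_q$, $H_j$ on vertex set $\{v^1_j,\dots,v^m_j\}$, such that for every ordered pair $(a,b)$ of distinct elements of $[m]$ there is exactly one $j$ with $v^a_jv^b_j\in A(H_j)$ and there are no other arcs; it is a relabel $H$-factorization if every $H_j$ is isomorphic to $H$. The lexicographic product $D[H]$ has vertex set $V(D)\times V(H)$, with an arc from $(u,a)$ to $(v,b)$ iff $uv\in A(D)$, or $u=v$ and $ab\in A(H)$. -}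

module Defs where

open import Data.Nat using (ℕ; zero; suc; _*_; _≤_; _<_; _≥_)
open import Data.Fin using (Fin; zero; suc; inject₁; fromℕ; combine; remQuot; _≟_)
open import Data.Fin.Properties using () renaming (_≟_ to _≟F_)
open import Data.Bool using (Bool; true; false; _∧_; _∨_; not)
open import Data.Product using (Σ; ∃; ∃-syntax; _×_; _,_; proj₁; proj₂)
open import Data.List using (length; filter)
open import Data.List using () renaming (allFin to allFinL)
open import Relation.Binary.PropositionalEquality using (_≡_; _≢_; refl)
open import Relation.Nullary.Decidable using (⌊_⌋)
open import Function.Definitions using (Injective)
open import Function.Bundles using (_↔_; Inverse)

record Digraph : Set where
  field
    size     : ℕ
    arc      : Fin size → Fin size → Bool
    loopless : ∀ v → arc v v ≡ false
open Digraph public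

Arc : (D : Digraph) → Fin (size D) → Fin (size D) → Set
Arc D u v = arc D u v ≡ true

-- Complete symmetric digraph K_m is not needed explicitly: the relabel
-- factorization condition refers to all ordered pairs of distinct labels.

record Coloring (D : Digraph) (k : ℕ) : Set where
  field
    col  : Fin (size D) → Fin k
    surj : ∀ (i : Fin k) → ∃[ v ] col v ≡ i
open Coloring public

record DirectedCycle (D : Digraph) : Set where
  field
    len    : ℕ
    vtx    : Fin (suc (suc len)) → Fin (size D)
    inj    : Injective _≡_ _≡_ vtx
    step   : ∀ (j : Fin (suc len)) → Arc D (vtx (inject₁ j)) (vtx (suc j))
    close  : Arc D (vtx (fromℕ (suc len))) (vtx zero)
open DirectedCycle public

-- Acyclic coloring: no chromatic class contains (the vertex set of) a
-- directed cycle, i.e. each class induces a subdigraph without directed cycles.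
Acyclic : {D : Digraph} {k : ℕ} → Coloring D k → Set
Acyclic {D} c = (C : DirectedCycle D) (i : Fin _) →
  ¬' (∀ j → col c (vtx C j) ≡ i)
  where
    open import Data.Empty using (⊥)
    ¬' : Set → Set
    ¬' P = P → ⊥

Complete : {D : Digraph} {k : ℕ} → Coloring D k → Set
Complete {D} {k} c = (i j : Fin k) → i ≢ j →
  ∃[ u ] ∃[ v ] (col c u ≡ i × col c v ≡ j × Arc D u v)

classSize : {D : Digraph} {k : ℕ} → Coloring D k → Fin k → ℕ
classSize {D} c i = length (filter (λ v → col c v ≟F i) (allFinL (size D)))

BalancedOfSize : {D : Digraph} {k : ℕ} → Coloring D k → ℕ → Set
BalancedOfSize c q = ∀ i → classSize c i ≡ q

Balanced : {D : Digraph} {k : ℕ} → Coloring D k → Set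
Balanced c = ∀ i j → classSize c i ≡ classSize c j

HasACC : Digraph → ℕ → Set
HasACC D k = Σ (Coloring D k) λ c → Acyclic c × Complete c

DacIs : Digraph → ℕ → Set
DacIs D k = HasACC D k × (∀ k' → HasACC D k' → k' ≤ k)

deleteArc : (D : Digraph) → Fin (size D) → Fin (size D) → Digraph
deleteArc D u v = record
  { size     = size D
  ; arc      = λ x y → arc D x y ∧ not (⌊ x ≟F u ⌋ ∧ ⌊ y ≟F v ⌋)
  ; loopless = λ x → lemma x
  }
  where
    lemma : ∀ x → (arc D x x ∧ not (⌊ x ≟F u ⌋ ∧ ⌊ x ≟F v ⌋)) ≡ false
    lemma x with arc D x x | loopless D x
    ... | false | _ = refl

IsMinimal : Digraph → ℕ → Set
IsMinimal D k = DacIs D k ×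
  (∀ u v → Arc D u v → ∀ k' → HasACC (deleteArc D u v) k' → k' < k)

Iso : Digraph → Digraph → Set
Iso G H = Σ (Fin (size G) ↔ Fin (size H)) λ σ →
  ∀ x y → arc H (Inverse.to σ x) (Inverse.to σ y) ≡ arc G x y

-- A relabel H-factorization of K_m into q factors: digraphs H_1,…,H_q, where
-- H_j has vertex set {v^1_j,…,v^m_j} (vertex v^a_j is represented by the label
-- a : Fin m), each H_j is isomorphic to H, and for each ordered pair (a , b) of
-- distinct labels there is exactly one j with v^a_j v^b_j an arc of H_j; there
-- are no other arcs (loops are excluded since digraphs are simple).  The H_j are
-- pairwise vertex-disjoint by construction (distinct indices j).
record RelabelFactorization (m q : ℕ) (H : Digraph) : Set where
  field
    farc       : Fin q → Fin m → Fin m → Bool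
    floopless  : ∀ j a → farc j a a ≡ false
  factor : Fin q → Digraph
  factor j = record { size = m ; arc = farc j ; loopless = floopless j }
  field
    isoH       : ∀ j → Iso (factor j) H
    exactlyOne : ∀ (a b : Fin m) → a ≢ b →
      ∃[ j ] (Arc (factor j) a b × (∀ j' → Arc (factor j') a b → j' ≡ j))

-- Lexicographic product D[H] on vertex set Fin (size D * size H), where
-- (u , x) is encoded as combine u x : (u,x) → (v,y) iff uv ∈ A(D), or u = v and xy ∈ A(H).
pairArc : (D H : Digraph) → Fin (size D) × Fin (size H) → Fin (size D) × Fin (size H) → Bool
pairArc D H (u , x) (v , y) = arc D u v ∨ (⌊ u ≟F v ⌋ ∧ arc H x y)

lexArc : (D H : Digraph) → Fin (size D * size H) → Fin (size D * size H) → Bool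
lexArc D H p p' = pairArc D H (remQuot (size H) p) (remQuot (size H) p')

pairLoopless : (D H : Digraph) → ∀ w → pairArc D H w w ≡ false
pairLoopless D H (u , x) rewrite loopless D u | loopless H x with ⌊ u ≟F u ⌋
... | true = refl
... | false = refl

lexLoopless : (D H : Digraph) → ∀ p → lexArc D H p p ≡ false
lexLoopless D H p = pairLoopless D H (remQuot (size H) p)

lex : Digraph → Digraph → Digraph
lex D H = record { size = size D * size H ; arc = lexArc D H ; loopless = lexLoopless D H }

-- Call a coloring tight if every arc joins two different classes and is the only arc
-- from the first of them to the second.  A complete acyclic coloring of a k-minimal digraph
-- with k colors is tight: otherwise some arc could be deleted keeping it acyclic and complete.
-- Conversely a tight complete coloring with N colors makes its digraph N-minimal: a complete
-- coloring with k′ colors chooses an arc for each ordered pair of its colors, and tightness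
-- makes the pairs of tight colors of the chosen arcs distinct, so k′(k′ − 1) ≤ N(N − 1); after
-- deleting an arc f, the tight color pair of f is missed, so the inequality becomes strict.
--
-- In D[H], number each color class of D by 1, …, q and give (u , x) the color (i , a), where
-- i is the color of u and a is the label of x in the factor H_j, j being the number of u.
-- Arcs of D keep distinct class pairs, and an arc inside a copy of H gets the pair
-- ((i , a) , (i , b)), which the factorization assigns to exactly one factor, hence to exactly
-- one vertex of class i.  So this coloring is tight and complete, and its class (i , a) is in
-- bijection with the class i of D.

{-# OPTIONS --safe #-}
module Submission where

open import Defs
open import Axiom.UniquenessOfIdentityProofs using (module Decidable⇒UIP)
open import Data.Bool using (true; false)
open import Data.Empty using (⊥-elim)
open import Data.Fin using (Fin; zero; suc; punchIn; punchOut; combine; remQuot)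
open import Data.Fin.Permutation using (↔⇒≡)
open import Data.Fin.Properties
  using (_≟_; ¬Fin0; injective⇒≤; punchInᵢ≢i; punchIn-punchOut; punchOut-cong; punchOut-punchIn;
         combine-injective; combine-injectiveˡ; combine-injectiveʳ; combine-surjective;
         remQuot-combine; combine-remQuot; *↔×)
open import Data.List using (length; filter; tabulate)
open import Data.Nat using (ℕ; zero; suc; pred; _*_; _≤_; _<_; _≥_; z≤n)
open import Data.Nat.Properties using (*-mono-≤; *-mono-<; pred-mono-≤; n<1+n; <-≤-trans; <-irrefl; <⇒≱; ≰⇒>; ≮⇒≥)
open import Data.Product using (Σ; ∃-syntax; _×_; _,_; proj₁; proj₂; uncurry)
import Data.Product as Product
open import Data.Sum using (_⊎_; inj₁; inj₂)
open import Function using (_∘_; id)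
open import Function.Bundles using (_↔_; Inverse; Injection; mk↔ₛ′)
open import Function.Construct.Composition using (_↔-∘_)
open import Function.Construct.Symmetry using (↔-sym)
open import Function.Definitions using (Injective)
open import Function.Properties.Inverse using (↔⇒↣)
open import Relation.Binary.PropositionalEquality
open import Relation.Nullary using (Irrelevant; ¬_; yes; no; contradiction)
open import Relation.Nullary.Decidable using (_×-dec_)
open import Relation.Nullary.Recomputable using (¬-recompute)
open import Relation.Unary using (Decidable)

private variable
  m n k N : ℕ
  D H    : Digraph

injective∧missing⇒< : {f : Fin m → Fin n} → Injective _≡_ _≡_ f →
                      (y : Fin n) → (∀ x → f x ≢ y) → m < n
injective∧missing⇒< {m} {n} {f} f-inj y missed = injective⇒≤ g-inj
  where
    g : Fin (suc m) → Fin n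
    g zero    = y
    g (suc x) = f x

    g-inj : Injective _≡_ _≡_ g
    g-inj {zero}  {zero}   _ = refl
    g-inj {zero}  {suc x′} e = contradiction (sym e) (missed x′)
    g-inj {suc x} {zero}   e = contradiction e (missed x)
    g-inj {suc x} {suc x′} e = cong suc (f-inj e)

-- The irrelevant proof field makes pairs equal as soon as their components are.
record DistinctPair (n : ℕ) : Set where
  constructor _↦_∣_
  field
    fst snd   : Fin n
    .distinct : fst ≢ snd
open DistinctPair public

distinctPair-≡ : {p p′ : DistinctPair n} → fst p ≡ fst p′ → snd p ≡ snd p′ → p ≡ p′
distinctPair-≡ {p = _ ↦ _ ∣ _} {_ ↦ _ ∣ _} refl refl = refl

distinctPair↔ : ∀ n → DistinctPair n ↔ Fin (n * pred n)
distinctPair↔ zero    = mk↔ₛ′ empty (λ ()) (λ ()) (λ p → empty p)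
  where
    empty : ∀ {A : Set} → DistinctPair 0 → A
    empty p = ⊥-elim (¬Fin0 (fst p))
distinctPair↔ (suc n) = mk↔ₛ′ encode decode encode-decode decode-encode
  where
    encode : DistinctPair (suc n) → Fin (suc n * n)
    encode (i ↦ j ∣ i≢j) = combine i (punchOut (¬-recompute i≢j))

    decode : Fin (suc n * n) → DistinctPair (suc n)
    decode x = let i , j = remQuot n x in i ↦ punchIn i j ∣ (punchInᵢ≢i i j ∘ sym)

    encode-decode : ∀ x → encode (decode x) ≡ x
    encode-decode x = trans (cong (combine i) (trans (punchOut-cong i refl) (punchOut-punchIn i)))
                            (combine-remQuot n x)
      where i = proj₁ (remQuot n x)

    decode-encode : ∀ p → decode (encode p) ≡ p
    decode-encode (i ↦ j ∣ i≢j) =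
      distinctPair-≡ (cong proj₁ eq) (trans (cong (uncurry punchIn) eq) (punchIn-punchOut _))
      where eq = remQuot-combine {k = n} i (punchOut (¬-recompute i≢j))

*-pred-mono-≤ : m ≤ n → m * pred m ≤ n * pred n
*-pred-mono-≤ m≤n = *-mono-≤ m≤n (pred-mono-≤ m≤n)

*-pred-cancel-< : m * pred m < n * pred n → m < n
*-pred-cancel-< lt = ≰⇒> λ n≤m → <⇒≱ lt (*-pred-mono-≤ n≤m)

*-pred-cancel-≤ : m * pred m ≤ suc n * n → m ≤ suc n
*-pred-cancel-≤ {m} {n} le = ≮⇒≥ λ 1+n<m →
  <⇒≱ (<-≤-trans (*-mono-< (n<1+n (suc n)) (n<1+n n)) (*-pred-mono-≤ 1+n<m)) le

private
  viaFin : (DistinctPair m → DistinctPair n) → Fin (m * pred m) → Fin (n * pred n)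
  viaFin {m} {n} f = Inverse.to (distinctPair↔ n) ∘ f ∘ Inverse.from (distinctPair↔ m)

  toFin-injective : Injective _≡_ _≡_ (Inverse.to (distinctPair↔ n))
  toFin-injective {n} = Injection.injective (↔⇒↣ (distinctPair↔ n))

  viaFin-injective : {f : DistinctPair m → DistinctPair n} →
                     Injective _≡_ _≡_ f → Injective _≡_ _≡_ (viaFin f)
  viaFin-injective {m} f-inj =
    Injection.injective (↔⇒↣ (↔-sym (distinctPair↔ m))) ∘ f-inj ∘ toFin-injective

distinctPair-injective⇒≤ : {f : DistinctPair m → DistinctPair n} →
                           Injective _≡_ _≡_ f → (Fin m → Fin n) → m ≤ n
distinctPair-injective⇒≤ {zero}          _     _ = z≤n
distinctPair-injective⇒≤ {suc _} {zero}  _     g = ⊥-elim (¬Fin0 (g zero))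
distinctPair-injective⇒≤ {suc _} {suc _} f-inj _ = *-pred-cancel-≤ (injective⇒≤ (viaFin-injective f-inj))

distinctPair-injective∧missing⇒< : {f : DistinctPair m → DistinctPair n} → Injective _≡_ _≡_ f →
                                   (p : DistinctPair n) → (∀ x → f x ≢ p) → m < n
distinctPair-injective∧missing⇒< {m} {n} f-inj p missed =
  *-pred-cancel-< (injective∧missing⇒< (viaFin-injective f-inj) (Inverse.to (distinctPair↔ n) p)
    λ x eq → missed (Inverse.from (distinctPair↔ m) x) (toFin-injective eq))

Arc-deleteArc⁻ : ∀ {u v x y} → Arc (deleteArc D u v) x y → Arc D x y × ¬ (x ≡ u × y ≡ v)
Arc-deleteArc⁻ {D} {u} {v} {x} {y} a with arc D x y | x ≟ u | y ≟ v
Arc-deleteArc⁻ () | false | _ | _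
... | true | yes _   | yes _   = contradiction a λ ()
... | true | yes _   | no y≢v  = refl , y≢v ∘ proj₂
... | true | no x≢u  | _       = refl , x≢u ∘ proj₁

Arc-deleteArc⁺ : ∀ {u v x y} → Arc D x y → ¬ (x ≡ u × y ≡ v) → Arc (deleteArc D u v) x y
Arc-deleteArc⁺ {D} {u} {v} {x} {y} a ne with arc D x y | x ≟ u | y ≟ v
Arc-deleteArc⁺ () ne | false | _ | _
... | true | yes x≡u | yes y≡v = contradiction (x≡u , y≡v) ne
... | true | yes _   | no _    = refl
... | true | no _    | _       = refl

deleteArc-coloring : ∀ {u v} → Coloring D k → Coloring (deleteArc D u v) k
deleteArc-coloring c = record { col = col c ; surj = surj c }

deleteArc-cycle : ∀ {u v} → DirectedCycle (deleteArc D u v) → DirectedCycle D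
deleteArc-cycle {D} C = record
  { len   = len C
  ; vtx   = vtx C
  ; inj   = inj C
  ; step  = λ j → proj₁ (Arc-deleteArc⁻ {D} (step C j))
  ; close = proj₁ (Arc-deleteArc⁻ {D} (close C))
  }

deleteArc-acyclic : ∀ {u v} (c : Coloring D k) → Acyclic c → Acyclic (deleteArc-coloring {u = u} {v} c)
deleteArc-acyclic c acyclic C = acyclic (deleteArc-cycle C)

Replaceable : Coloring D k → Fin (size D) → Fin (size D) → Set
Replaceable {D} c u v =
  col c u ≡ col c v ⊎
  ∃[ u′ ] ∃[ v′ ] (Arc D u′ v′ × ¬ (u′ ≡ u × v′ ≡ v) × col c u′ ≡ col c u × col c v′ ≡ col c v)

deleteArc-complete : ∀ {u v} (c : Coloring D k) → Complete c → Replaceable c u v →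
                     Complete (deleteArc-coloring {u = u} {v} c)
deleteArc-complete {D} {u = u} {v} c complete replaceable i j i≢j with complete i j i≢j
... | x , y , cx , cy , a with x ≟ u ×-dec y ≟ v | replaceable
...   | no ne             | _ = x , y , cx , cy , Arc-deleteArc⁺ {D} a ne
...   | yes (refl , refl) | inj₁ cu≡cv = contradiction (trans (sym cx) (trans cu≡cv cy)) i≢j
...   | yes (refl , refl) | inj₂ (u′ , v′ , a′ , ne′ , cu′ , cv′) =
  u′ , v′ , trans cu′ cx , trans cv′ cy , Arc-deleteArc⁺ {D} a′ ne′

record Tight (c : Coloring D k) : Set where
  field
    bichromatic : ∀ {u v} → Arc D u v → col c u ≢ col c v
    unique      : ∀ {u v u′ v′} → Arc D u v → Arc D u′ v′ →
                  col c u ≡ col c u′ → col c v ≡ col c v′ → u ≡ u′ × v ≡ v′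

minimal⇒tight : IsMinimal D k → (c : Coloring D k) → Acyclic c → Complete c → Tight c
minimal⇒tight {D} {k} minimal c acyclic complete = record
  { bichromatic = λ a cu≡cv → irreplaceable a (inj₁ cu≡cv)
  ; unique      = unique
  }
  where
    irreplaceable : ∀ {u v} → Arc D u v → ¬ Replaceable c u v
    irreplaceable {u} {v} a r = <-irrefl refl (proj₂ minimal u v a k
      (deleteArc-coloring c , deleteArc-acyclic c acyclic , deleteArc-complete c complete r))

    unique : ∀ {u v u′ v′} → Arc D u v → Arc D u′ v′ →
             col c u ≡ col c u′ → col c v ≡ col c v′ → u ≡ u′ × v ≡ v′
    unique {u} {v} {u′} {v′} a a′ cu cv with u′ ≟ u ×-dec v′ ≟ v
    ... | yes (refl , refl) = refl , refl
    ... | no ne = contradiction (inj₂ (u′ , v′ , a′ , ne , sym cu , sym cv)) (irreplaceable a)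

tight⇒acyclic : {c : Coloring D k} → Tight c → Acyclic c
tight⇒acyclic tight C i monochromatic =
  Tight.bichromatic tight (step C zero) (trans (monochromatic _) (sym (monochromatic _)))

module _ {G : Digraph} {c₀ : Coloring G N} (tight : Tight c₀) where
  open Tight tight

  arcColors : ∀ {x y} → Arc G x y → DistinctPair N
  arcColors {x} {y} a = col c₀ x ↦ col c₀ y ∣ bichromatic a

  private
    module Representatives
      (A : Fin (size G) → Fin (size G) → Set) (A⊆G : ∀ {x y} → A x y → Arc G x y)
      (c : Fin (size G) → Fin k)
      (complete : ∀ i j → i ≢ j → ∃[ x ] ∃[ y ] (c x ≡ i × c y ≡ j × A x y)) where

      representativeColors : DistinctPair k → DistinctPair N
      representativeColors (i ↦ j ∣ i≢j) with complete i j (¬-recompute i≢j)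
      ... | _ , _ , _ , _ , a = arcColors (A⊆G a)

      representativeColors-injective : Injective _≡_ _≡_ representativeColors
      representativeColors-injective {i ↦ j ∣ i≢j} {i′ ↦ j′ ∣ i′≢j′} eq
        with complete i j (¬-recompute i≢j) | complete i′ j′ (¬-recompute i′≢j′)
      ... | x , y , refl , refl , a | x′ , y′ , refl , refl , a′
        with unique (A⊆G a) (A⊆G a′) (cong fst eq) (cong snd eq)
      ... | refl , refl = refl

      representativeColors-avoid : ∀ {u v} (a : Arc G u v) → (∀ {x y} → A x y → ¬ (x ≡ u × y ≡ v)) →
                                    ∀ p → representativeColors p ≢ arcColors a
      representativeColors-avoid a avoid (i ↦ j ∣ i≢j) eq with complete i j (¬-recompute i≢j)
      ... | _ , _ , _ , _ , a′ = avoid a′ (unique (A⊆G a′) a (cong fst eq) (cong snd eq))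

  tight⇒HasACC-≤ : HasACC G k → k ≤ N
  tight⇒HasACC-≤ (c , _ , complete) =
    distinctPair-injective⇒≤ representativeColors-injective (λ i → col c₀ (proj₁ (surj c i)))
    where open Representatives (Arc G) id (col c) complete

  tight⇒deleteArc-HasACC-< : ∀ {u v} → Arc G u v → HasACC (deleteArc G u v) k → k < N
  tight⇒deleteArc-HasACC-< {u = u} {v} a (c , _ , complete) =
    distinctPair-injective∧missing⇒< representativeColors-injective (arcColors a)
      (representativeColors-avoid a (proj₂ ∘ Arc-deleteArc⁻ {G}))
    where open Representatives (Arc (deleteArc G u v)) (proj₁ ∘ Arc-deleteArc⁻ {G}) (col c) complete

tight∧complete⇒minimal : (c : Coloring D N) → Tight c → Complete c → IsMinimal D N
tight∧complete⇒minimal c tight complete =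
  ((c , tight⇒acyclic tight , complete) , λ _ → tight⇒HasACC-≤ tight) ,
  λ _ _ a _ → tight⇒deleteArc-HasACC-< tight a

module _ {B : Set} {P : B → Set} (P? : Decidable P) (P-irrelevant : ∀ {b} → Irrelevant (P b)) where

  filter-tabulate↔ : ∀ {n} (g : Fin n → B) → Σ (Fin n) (P ∘ g) ↔ Fin (length (filter P? (tabulate g)))
  filter-tabulate↔ g = mk↔ₛ′ (index g) (element g) (index-element g) (element-index g)
    where
      index : ∀ {n} (g : Fin n → B) → Σ (Fin n) (P ∘ g) → Fin (length (filter P? (tabulate g)))
      index {suc n} g (v , p) with P? (g zero)
      index {suc n} g (zero  , p) | yes _  = zero
      index {suc n} g (suc v , p) | yes _  = suc (index (g ∘ suc) (v , p))
      index {suc n} g (zero  , p) | no ¬p  = ⊥-elim (¬p p)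
      index {suc n} g (suc v , p) | no _   = index (g ∘ suc) (v , p)

      element : ∀ {n} (g : Fin n → B) → Fin (length (filter P? (tabulate g))) → Σ (Fin n) (P ∘ g)
      element {suc n} g j with P? (g zero)
      element {suc n} g zero    | yes p = zero , p
      element {suc n} g (suc j) | yes _ = Product.map suc id (element (g ∘ suc) j)
      element {suc n} g j       | no _  = Product.map suc id (element (g ∘ suc) j)

      index-element : ∀ {n} (g : Fin n → B) j → index g (element g j) ≡ j
      index-element {suc n} g j with P? (g zero)
      index-element {suc n} g zero    | yes p = refl
      index-element {suc n} g (suc j) | yes _ = cong suc (index-element (g ∘ suc) j)
      index-element {suc n} g j       | no _  = index-element (g ∘ suc) j

      element-index : ∀ {n} (g : Fin n → B) x → element g (index g x) ≡ x
      element-index {suc n} g (v , p) with P? (g zero)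
      element-index {suc n} g (zero  , p) | yes p′ = cong (zero ,_) (P-irrelevant p′ p)
      element-index {suc n} g (suc v , p) | yes _  = cong (Product.map suc id) (element-index (g ∘ suc) (v , p))
      element-index {suc n} g (zero  , p) | no ¬p  = ⊥-elim (¬p p)
      element-index {suc n} g (suc v , p) | no _   = cong (Product.map suc id) (element-index (g ∘ suc) (v , p))

Fibre : {D : Digraph} {k : ℕ} → Coloring D k → Fin k → Set
Fibre {D} c i = Σ (Fin (size D)) λ v → col c v ≡ i

module _ {D : Digraph} {k : ℕ} (c : Coloring D k) {i : Fin k} where
  open Decidable⇒UIP (_≟_ {k})

  fibre-≡ : {f f′ : Fibre c i} → proj₁ f ≡ proj₁ f′ → f ≡ f′
  fibre-≡ {_ , e} {_ , e′} refl = cong (_ ,_) (≡-irrelevant e e′)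

  fibre↔classSize : Fibre c i ↔ Fin (classSize c i)
  fibre↔classSize = filter-tabulate↔ (λ v → col c v ≟ i) ≡-irrelevant id

  fibre↔⇒classSize≡ : ∀ {s} → Fibre c i ↔ Fin s → classSize c i ≡ s
  fibre↔⇒classSize≡ e = ↔⇒≡ (e ↔-∘ ↔-sym fibre↔classSize)

LexArc : (D H : Digraph) → Fin (size D) × Fin (size H) → Fin (size D) × Fin (size H) → Set
LexArc D H (u , x) (v , y) = Arc D u v ⊎ (u ≡ v × Arc H x y)

pairArc⇒LexArc : ∀ w w′ → pairArc D H w w′ ≡ true → LexArc D H w w′
pairArc⇒LexArc {D} (u , x) (v , y) a with arc D u v | u ≟ v
... | true  | _        = inj₁ refl
... | false | yes refl = inj₂ (refl , a)

LexArc⇒pairArc : ∀ w w′ → LexArc D H w w′ → pairArc D H w w′ ≡ true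
LexArc⇒pairArc {D} (u , x) (v , y) (inj₁ a) rewrite a = refl
LexArc⇒pairArc {D} (u , x) (.u , y) (inj₂ (refl , a)) rewrite loopless D u with u ≟ u
... | yes _   = a
... | no u≢u = contradiction refl u≢u

Arc-lex⁻ : ∀ {p p′} → Arc (lex D H) p p′ → LexArc D H (remQuot (size H) p) (remQuot (size H) p′)
Arc-lex⁻ {D} {H} = pairArc⇒LexArc {D} {H} _ _

Arc-lex⁺ : ∀ {u x v y} → LexArc D H (u , x) (v , y) → Arc (lex D H) (combine u x) (combine v y)
Arc-lex⁺ {D} {H} {u} {x} {v} {y} a =
  trans (cong₂ (pairArc D H) (remQuot-combine u x) (remQuot-combine v y)) (LexArc⇒pairArc {D} {H} _ _ a)

module _ {m q : ℕ} {H : Digraph} (F : RelabelFactorization m q H) where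
  open RelabelFactorization F

  relabel : Fin q → Fin m ↔ Fin (size H)
  relabel j = proj₁ (isoH j)

  relabel-arc : ∀ j a b → arc H (Inverse.to (relabel j) a) (Inverse.to (relabel j) b) ≡ farc j a b
  relabel-arc j = proj₂ (isoH j)

  factor-unique : ∀ {j j′ a b} → Arc (factor j) a b → Arc (factor j′) a b → j ≡ j′
  factor-unique {j} {j′} {a} {b} ab ab′ with a ≟ b
  ... | yes refl = contradiction (trans (sym (floopless j a)) ab) λ ()
  ... | no a≢b with exactlyOne a b a≢b
  ...   | _ , _ , only = trans (only j ab) (sym (only j′ ab′))

module LexColoring {D H : Digraph} {k q m : ℕ}
  (c : Coloring D k) (tight : Tight c) (complete : Complete c) (balanced : BalancedOfSize c q)
  (F : RelabelFactorization m q H) where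

  open RelabelFactorization F using (factor; exactlyOne)

  fibre↔ : ∀ i → Fibre c i ↔ Fin q
  fibre↔ i = subst (λ s → Fibre c i ↔ Fin s) (balanced i) (fibre↔classSize c)

  position : Fin (size D) → Fin q
  position u = Inverse.to (fibre↔ (col c u)) (u , refl)

  position-at : ∀ {u i} (e : col c u ≡ i) → position u ≡ Inverse.to (fibre↔ i) (u , e)
  position-at refl = refl

  position-injective : ∀ {u u′} → col c u ≡ col c u′ → position u ≡ position u′ → u ≡ u′
  position-injective {u} {u′} e eq =
    cong proj₁ (Injection.injective (↔⇒↣ (fibre↔ (col c u′))) (trans (sym (position-at e)) eq))

  position-surjective : ∀ i j → ∃[ u ] (col c u ≡ i × position u ≡ j)
  position-surjective i j with Inverse.from (fibre↔ i) j in eq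
  ... | u , e = u , e , (begin
    position u                                        ≡⟨ position-at e ⟩
    Inverse.to (fibre↔ i) (u , e)                     ≡⟨ cong (Inverse.to (fibre↔ i)) eq ⟨
    Inverse.to (fibre↔ i) (Inverse.from (fibre↔ i) j) ≡⟨ Inverse.strictlyInverseˡ (fibre↔ i) j ⟩
    j                                                 ∎)
    where open ≡-Reasoning

  label : Fin (size D) → Fin (size H) → Fin m
  label u = Inverse.from (relabel F (position u))

  embed : Fin (size D) → Fin m → Fin (size H)
  embed u = Inverse.to (relabel F (position u))

  embed-label : ∀ u x → embed u (label u x) ≡ x
  embed-label u = Inverse.strictlyInverseˡ (relabel F (position u))

  label-embed : ∀ u a → label u (embed u a) ≡ a
  label-embed u = Inverse.strictlyInverseʳ (relabel F (position u))

  label-injective : ∀ u {x y} → label u x ≡ label u y → x ≡ y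
  label-injective u = Injection.injective (↔⇒↣ (↔-sym (relabel F (position u))))

  embed-arc : ∀ u {a b} → Arc (factor (position u)) a b → Arc H (embed u a) (embed u b)
  embed-arc u {a} {b} ab = trans (relabel-arc F (position u) a b) ab

  label-arc : ∀ u {x y} → Arc H x y → Arc (factor (position u)) (label u x) (label u y)
  label-arc u {x} {y} xy = trans (sym (relabel-arc F (position u) _ _))
                                 (trans (cong₂ (arc H) (embed-label u x) (embed-label u y)) xy)

  pairColor : Fin (size D) × Fin (size H) → Fin (k * m)
  pairColor (u , x) = combine (col c u) (label u x)

  color : Fin (size D * size H) → Fin (k * m)
  color = pairColor ∘ remQuot (size H)

  pairColor-parts : ∀ {u x v y} → pairColor (u , x) ≡ pairColor (v , y) →
                     col c u ≡ col c v × label u x ≡ label v y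
  pairColor-parts = combine-injective _ _ _ _

  color-embed : ∀ {u i} a → col c u ≡ i → color (combine u (embed u a)) ≡ combine i a
  color-embed {u} {i} a e = begin
    color (combine u (embed u a))          ≡⟨ cong pairColor (remQuot-combine u (embed u a)) ⟩
    combine (col c u) (label u (embed u a)) ≡⟨ cong₂ combine e (label-embed u a) ⟩
    combine i a                             ∎
    where open ≡-Reasoning

  pairColor-bichromatic : ∀ {w w′} → LexArc D H w w′ → pairColor w ≢ pairColor w′
  pairColor-bichromatic (inj₁ uv) eq = Tight.bichromatic tight uv (proj₁ (pairColor-parts eq))
  pairColor-bichromatic {u , x} (inj₂ (refl , xy)) eq
    with label-injective u (proj₂ (pairColor-parts eq))
  ... | refl = contradiction (trans (sym (loopless H x)) xy) λ ()

  pairColor-unique₁ : ∀ {u₁ x₁ v₁ y₁ u₂ x₂ v₂ y₂} →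
    LexArc D H (u₁ , x₁) (v₁ , y₁) → LexArc D H (u₂ , x₂) (v₂ , y₂) →
    pairColor (u₁ , x₁) ≡ pairColor (u₂ , x₂) → pairColor (v₁ , y₁) ≡ pairColor (v₂ , y₂) →
    u₁ ≡ u₂ × v₁ ≡ v₂
  pairColor-unique₁ (inj₁ a₁) (inj₁ a₂) e e′ =
    Tight.unique tight a₁ a₂ (proj₁ (pairColor-parts e)) (proj₁ (pairColor-parts e′))
  pairColor-unique₁ (inj₁ a₁) (inj₂ (refl , _)) e e′ =
    contradiction (trans (proj₁ (pairColor-parts e)) (sym (proj₁ (pairColor-parts e′))))
                  (Tight.bichromatic tight a₁)
  pairColor-unique₁ (inj₂ (refl , _)) (inj₁ a₂) e e′ =
    contradiction (trans (sym (proj₁ (pairColor-parts e))) (proj₁ (pairColor-parts e′)))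
                  (Tight.bichromatic tight a₂)
  pairColor-unique₁ {u₁} {x₁} {_} {y₁} {u₂} {x₂} {_} {y₂} (inj₂ (refl , xy₁)) (inj₂ (refl , xy₂)) e e′ =
    same , same
    where
      lab₂ : Arc (factor (position u₂)) (label u₁ x₁) (label u₁ y₁)
      lab₂ = subst₂ (Arc (factor (position u₂))) (sym (proj₂ (pairColor-parts e)))
                    (sym (proj₂ (pairColor-parts e′))) (label-arc u₂ xy₂)

      same : u₁ ≡ u₂
      same = position-injective (proj₁ (pairColor-parts e))
                                (factor-unique F (label-arc u₁ xy₁) lab₂)

  pairColor-unique : ∀ {w₁ w₁′ w₂ w₂′} → LexArc D H w₁ w₁′ → LexArc D H w₂ w₂′ →
    pairColor w₁ ≡ pairColor w₂ → pairColor w₁′ ≡ pairColor w₂′ → w₁ ≡ w₂ × w₁′ ≡ w₂′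
  pairColor-unique {u₁ , x₁} {v₁ , y₁} {u₂ , x₂} {v₂ , y₂} a₁ a₂ e e′
    with pairColor-unique₁ a₁ a₂ e e′
  ... | refl , refl =
    cong (u₁ ,_) (label-injective u₁ (proj₂ (pairColor-parts e))) ,
    cong (v₁ ,_) (label-injective v₁ (proj₂ (pairColor-parts e′)))

  color-surjective : ∀ α → ∃[ p ] color p ≡ α
  color-surjective α with combine-surjective {k} {m} α
  ... | i , a , refl with surj c i
  ...   | u , e = combine u (embed u a) , color-embed a e

  coloring : Coloring (lex D H) (k * m)
  coloring = record { col = color ; surj = color-surjective }

  coloring-tight : Tight coloring
  coloring-tight = record
    { bichromatic = pairColor-bichromatic ∘ Arc-lex⁻ {D} {H}
    ; unique      = λ a₁ a₂ e e′ → Product.map remQuot-injective remQuot-injective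
                      (pairColor-unique (Arc-lex⁻ {D} {H} a₁) (Arc-lex⁻ {D} {H} a₂) e e′)
    }
    where remQuot-injective = Injection.injective (↔⇒↣ (*↔× {size D} {size H}))

  coloring-complete : Complete coloring
  coloring-complete α β α≢β
    with combine-surjective {k} {m} α | combine-surjective {k} {m} β
  ... | i , a , refl | j , b , refl with i ≟ j
  ...   | no i≢j with complete i j i≢j
  ...     | u , v , cu , cv , uv =
    combine u (embed u a) , combine v (embed v b) , color-embed a cu , color-embed b cv ,
    Arc-lex⁺ {D} {H} (inj₁ uv)
  coloring-complete α β α≢β | i , a , refl | .i , b , refl | yes refl
    with exactlyOne a b (α≢β ∘ cong (combine i))
  ...     | j , ab , _ with position-surjective i j
  ...       | u , cu , refl =
    combine u (embed u a) , combine u (embed u b) , color-embed a cu , color-embed b cu ,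
    Arc-lex⁺ {D} {H} (inj₂ (refl , embed-arc u ab))

  lexFibre↔ : ∀ i a → Fibre coloring (combine i a) ↔ Fibre c i
  lexFibre↔ i a = mk↔ₛ′ base lift base-lift lift-base
    where
      base : Fibre coloring (combine i a) → Fibre c i
      base (p , e) = proj₁ (remQuot (size H) p) , combine-injectiveˡ _ _ _ _ e

      lift : Fibre c i → Fibre coloring (combine i a)
      lift (u , e) = combine u (embed u a) , color-embed a e

      base-lift : ∀ f → base (lift f) ≡ f
      base-lift (u , _) = fibre-≡ c (cong proj₁ (remQuot-combine u (embed u a)))

      lift-base : ∀ f → lift (base f) ≡ f
      lift-base (p , e) = fibre-≡ coloring (begin
        combine u (embed u a)           ≡⟨ cong (combine u ∘ embed u) label≡a ⟨
        combine u (embed u (label u x)) ≡⟨ cong (combine u) (embed-label u x) ⟩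
        combine u x                     ≡⟨ combine-remQuot {size D} (size H) p ⟩
        p                               ∎)
        where
          open ≡-Reasoning
          u = proj₁ (remQuot {size D} (size H) p)
          x = proj₂ (remQuot {size D} (size H) p)
          label≡a = combine-injectiveʳ (col c u) (label u x) i a e

  coloring-balanced : Balanced coloring
  coloring-balanced α β = trans (classSize-q α) (sym (classSize-q β))
    where
      classSize-q : ∀ α → classSize coloring α ≡ q
      classSize-q α with combine-surjective {k} {m} α
      ... | i , a , refl = fibre↔⇒classSize≡ coloring (fibre↔ i ↔-∘ lexFibre↔ i a)

corollary4 : (D : Digraph) (k q m : ℕ) (H : Digraph) →
    IsMinimal D k →
    Σ (Coloring D k) (λ c → Acyclic c × Complete c × BalancedOfSize c q) →
    m ≥ 2 →
    RelabelFactorization m q H →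
    IsMinimal (lex D H) (k * m)
      × Σ (Coloring (lex D H) (k * m)) (λ c → Acyclic c × Complete c × Balanced c)
corollary4 D k q m H minimal (c , acyclic , complete , balanced) _ F =
  tight∧complete⇒minimal coloring coloring-tight coloring-complete ,
  coloring , tight⇒acyclic coloring-tight , coloring-complete , coloring-balanced
  where open LexColoring c (minimal⇒tight minimal c acyclic complete) complete balanced F
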